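{- Let $G_1,G_2$ be positive integers and let $(G_n)_{n\geq1}$ be the Gibonacci sequence defined by $G_n=G_{n-1}+G_{n-2}$ for $n\geq3$. Define $a_0^{\{G_1,G_2\}}(m)=G_m$ for $m\geq1$, and for $k\geq1$ define $a_k^{\{G_1,G_2\}}(m)=\sum_{i=1}^{m}a_{k-1}^{\{G_1,G_2\}}(i)$ for $m\geq1$; set $a_k^{\{G_1,G_2\}}(m)=0$ for $m\leq0$. For integers $n\geq1$ and $k\geq0$ define \[s_k^{\{G_1,G_2\}}(n)=\sum_{\ell\geq k}\left(\binom{n-\ell}{\ell}G_2+\binom{n-\ell}{\ell-1}G_1\right).\] Then for all $k\geq0$ and $n\geq1$, \[s_k^{\{G_1,G_2\}}(n)=a_k^{\{G_1,G_2\}}\big(n-2(k-1)\big).\]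
   Context: Binomial coefficient convention: for integers $m,j$, $\binom{m}{j}$ is the number of $j$-element subsets of an $m$-element set when $m,j\geq0$ (so it is $0$ if $j>m$), and $\binom{m}{j}=0$ if $j<0$ or $m<0$. Combinatorially, $s_k^{\{G_1,G_2\}}(n)$ counts colored Schreier sets: subsets $S\subseteq\{1,\dots,n\}$ with $|S|\geq k$ and $\min S\geq|S|$, where if $\min S=|S|$ the element $|S|$ carries one of $G_1$ colors, and if $\min S>|S|$ one distinguished element carries one of $G_2$ colors. -}

module Defs where

open import Data.Nat using (ℕ; zero; suc; _+_; _*_; _∸_)
open import Data.Nat.Combinatorics using (_C_)
open import Data.Integer using (ℤ; +_; -[1+_])

-- Gibonacci sequence G_1 = g₁, G_2 = g₂, G_n = G_{n-1} + G_{n-2} (n ≥ 3).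
-- The value at index 0 is irrelevant (never used); set to 0.
gib : ℕ → ℕ → ℕ → ℕ
gib g₁ g₂ zero = 0
gib g₁ g₂ (suc zero) = g₁
gib g₁ g₂ (suc (suc zero)) = g₂
gib g₁ g₂ (suc (suc (suc n))) = gib g₁ g₂ (suc (suc n)) + gib g₁ g₂ (suc n)

sum1 : ℕ → (ℕ → ℕ) → ℕ
sum1 zero f = 0
sum1 (suc m) f = sum1 m f + f (suc m)

aN : ℕ → ℕ → ℕ → ℕ → ℕ
aN g₁ g₂ zero zero = 0
aN g₁ g₂ zero (suc m) = gib g₁ g₂ (suc m)
aN g₁ g₂ (suc k) m = sum1 m (aN g₁ g₂ k)

a : ℕ → ℕ → ℕ → ℤ → ℕ
a g₁ g₂ k (+ m) = aN g₁ g₂ k m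
a g₁ g₂ k -[1+ m ] = 0

binom : ℤ → ℤ → ℕ
binom (+ m) (+ j) = m C j
binom (+ m) -[1+ j ] = 0
binom -[1+ m ] j = 0

sumFrom : ℕ → ℕ → (ℕ → ℕ) → ℕ
sumFrom k zero f = 0
sumFrom k (suc len) f = f k + sumFrom (suc k) len f

open import Data.Integer using (_-_) renaming (_+_ to _+ℤ_)

sTerm : ℕ → ℕ → ℕ → ℕ → ℕ
sTerm g₁ g₂ n ℓ = binom (+ n - + ℓ) (+ ℓ) * g₂ + binom (+ n - + ℓ) (+ ℓ - + 1) * g₁

-- s_k(n) = Σ_{ℓ ≥ k} sTerm ℓ.  Terms with ℓ > n vanish (n - ℓ < 0), so the
-- sum over ℓ ∈ [k, k + n] contains every nonzero term.
s : ℕ → ℕ → ℕ → ℕ → ℕ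
s g₁ g₂ k n = sumFrom k (suc n) (sTerm g₁ g₂ n)

{-# OPTIONS --safe #-}
module Submission where

-- Both sides satisfy f (k+1) (n+2) = f (k+1) (n+1) + f k n: for s this is Pascal's rule
-- applied termwise after the shift ℓ ↦ ℓ + 1, for a it is a_{k+1}(m) = a_{k+1}(m-1) + a_k(m).
-- For k = 0 both obey the Gibonacci recurrence (s₀ = G₂ + s₁), and at n = 0, 1 they agree
-- directly.

open import Defs
open import Data.Nat using (ℕ; _≥_)
open import Data.Integer using (+_; _-_; _*_)
open import Relation.Binary.PropositionalEquality using (_≡_)

open import Function using (_∘_)
open import Data.Nat.Base as ℕ using (zero; suc; _+_; _∸_; _≤_; _<_; s≤s; z≤n)
open import Data.Nat.Properties
  using ( +-comm; +-assoc; +-identityʳ; +-suc; *-suc; 0∸n≡0; m≤n⇒m∸n≡0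
        ; ≤-refl; ≤-reflexive; ≤-trans; <⇒≤; n≤1+n; m+n≤o⇒n≤o; *-monoʳ-≤ )
open import Data.Nat.Tactic.RingSolver using (solve-∀)
open import Data.Nat.Combinatorics using (_C_; nCk+nC[k+1]≡[n+1]C[k+1])
open import Data.Integer.Base using (ℤ; _⊖_) renaming (_+_ to _+ℤ_)
open import Data.Integer.Properties using ([1+m]⊖[1+n]≡m⊖n; m-n≡m⊖n; pos-*)
import Data.Integer.Tactic.RingSolver as ℤ-Ring
open import Relation.Binary.PropositionalEquality using (refl; sym; trans; cong; cong₂; module ≡-Reasoning)
open ≡-Reasoning

chooseDiff : ℕ → ℕ → ℕ → ℕ
chooseDiff n       zero    j = n C j
chooseDiff zero    (suc ℓ) j = 0
chooseDiff (suc n) (suc ℓ) j = chooseDiff n ℓ j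

binom-⊖ : ∀ n ℓ j → binom (n ⊖ ℓ) (+ j) ≡ chooseDiff n ℓ j
binom-⊖ n       zero    j = refl
binom-⊖ zero    (suc ℓ) j = refl
binom-⊖ (suc n) (suc ℓ) j =
  trans (cong (λ d → binom d (+ j)) ([1+m]⊖[1+n]≡m⊖n n ℓ)) (binom-⊖ n ℓ j)

binom-diff : ∀ n ℓ j → binom (+ n - + ℓ) (+ j) ≡ chooseDiff n ℓ j
binom-diff n ℓ j = trans (cong (λ d → binom d (+ j)) (m-n≡m⊖n n ℓ)) (binom-⊖ n ℓ j)

chooseDiff-pascal : ∀ n ℓ j → chooseDiff (suc n) ℓ (suc j) ≡ chooseDiff n ℓ j + chooseDiff n ℓ (suc j)
chooseDiff-pascal n       zero          j = sym (nCk+nC[k+1]≡[n+1]C[k+1] n j)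
chooseDiff-pascal zero    (suc zero)    j = refl
chooseDiff-pascal zero    (suc (suc ℓ)) j = refl
chooseDiff-pascal (suc n) (suc ℓ)       j = chooseDiff-pascal n ℓ j

chooseDiff-vanish : ∀ {n ℓ} j → n < ℓ → chooseDiff n ℓ j ≡ 0
chooseDiff-vanish {zero}  {suc ℓ} j _       = refl
chooseDiff-vanish {suc n} {suc ℓ} j (s≤s p) = chooseDiff-vanish j p

module _ {f g : ℕ → ℕ} where

  sumFrom-cong : ∀ k L → (∀ ℓ → f ℓ ≡ g ℓ) → sumFrom k L f ≡ sumFrom k L g
  sumFrom-cong k zero    f≡g = refl
  sumFrom-cong k (suc L) f≡g = cong₂ _+_ (f≡g k) (sumFrom-cong (suc k) L f≡g)

  sumFrom-+ : ∀ k L → sumFrom k L (λ ℓ → f ℓ + g ℓ) ≡ sumFrom k L f + sumFrom k L g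
  sumFrom-+ k zero    = refl
  sumFrom-+ k (suc L) = trans (cong (_+_ (f k + g k)) (sumFrom-+ (suc k) L)) (interchange (f k) (g k) _ _)
    where
    interchange : ∀ a b c d → a + b + (c + d) ≡ a + c + (b + d)
    interchange = solve-∀

module _ {f : ℕ → ℕ} where

  sumFrom-suc : ∀ k L → sumFrom (suc k) L f ≡ sumFrom k L (f ∘ suc)
  sumFrom-suc k zero    = refl
  sumFrom-suc k (suc L) = cong (_+_ (f (suc k))) (sumFrom-suc (suc k) L)

  sumFrom-≡0 : ∀ k L → (∀ {ℓ} → k ≤ ℓ → f ℓ ≡ 0) → sumFrom k L f ≡ 0
  sumFrom-≡0 k zero    f≡0 = refl
  sumFrom-≡0 k (suc L) f≡0 = cong₂ _+_ (f≡0 ≤-refl) (sumFrom-≡0 (suc k) L (f≡0 ∘ <⇒≤))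

  sumFrom-vanishing-tail : ∀ k L d → (∀ {ℓ} → k + L ≤ ℓ → f ℓ ≡ 0) → sumFrom k (d + L) f ≡ sumFrom k L f
  sumFrom-vanishing-tail k L d f≡0 = trans (cong (λ M → sumFrom k M f) (+-comm d L)) (drop k L f≡0)
    where
    drop : ∀ k L → (∀ {ℓ} → k + L ≤ ℓ → f ℓ ≡ 0) → sumFrom k (L + d) f ≡ sumFrom k L f
    drop k zero    f≡0 = sumFrom-≡0 k d (f≡0 ∘ ≤-trans (≤-reflexive (+-identityʳ k)))
    drop k (suc L) f≡0 = cong (_+_ (f k)) (drop (suc k) L (f≡0 ∘ ≤-trans (≤-reflexive (+-suc k L))))

module _ (g₁ g₂ : ℕ) where

  term : ℕ → ℕ → ℕ
  term n zero    = g₂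
  term n (suc ℓ) = chooseDiff n (suc ℓ) (suc ℓ) ℕ.* g₂ + chooseDiff n (suc ℓ) ℓ ℕ.* g₁

  sTerm≡term : ∀ n ℓ → sTerm g₁ g₂ n ℓ ≡ term n ℓ
  sTerm≡term n zero    = trans (+-identityʳ _) (+-identityʳ g₂)
  sTerm≡term n (suc ℓ) =
    cong₂ (λ x y → x ℕ.* g₂ + y ℕ.* g₁) (binom-diff n (suc ℓ) (suc ℓ)) (binom-diff n (suc ℓ) ℓ)

  term-vanish : ∀ {n ℓ} → n < ℓ → term n ℓ ≡ 0
  term-vanish {ℓ = suc ℓ} n<ℓ =
    cong₂ (λ x y → x ℕ.* g₂ + y ℕ.* g₁) (chooseDiff-vanish (suc ℓ) n<ℓ) (chooseDiff-vanish ℓ n<ℓ)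

  term-pascal : ∀ n ℓ → term (suc (suc n)) (suc ℓ) ≡ term (suc n) (suc ℓ) + term n ℓ
  term-pascal n zero =
    trans (cong (λ x → x ℕ.* g₂ + 1 ℕ.* g₁) (chooseDiff-pascal n 0 0)) (shuffle (n C 1) g₁ g₂)
    where
    shuffle : ∀ x a b → (1 + x) ℕ.* b + 1 ℕ.* a ≡ (x ℕ.* b + 1 ℕ.* a) + b
    shuffle = solve-∀
  term-pascal n (suc ℓ) =
    trans (cong₂ (λ x y → x ℕ.* g₂ + y ℕ.* g₁)
                 (chooseDiff-pascal n (suc ℓ) (suc ℓ)) (chooseDiff-pascal n (suc ℓ) ℓ))
          (shuffle (c (suc (suc ℓ))) (c (suc ℓ)) (c ℓ) g₁ g₂)
    where
    c : ℕ → ℕ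
    c = chooseDiff n (suc ℓ)
    shuffle : ∀ x y z a b → (y + x) ℕ.* b + (z + y) ℕ.* a ≡ (x ℕ.* b + y ℕ.* a) + (y ℕ.* b + z ℕ.* a)
    shuffle = solve-∀

  s′ : ℕ → ℕ → ℕ
  s′ k n = sumFrom k (suc n) (term n)

  s≡s′ : ∀ k n → s g₁ g₂ k n ≡ s′ k n
  s≡s′ k n = sumFrom-cong k (suc n) (sTerm≡term n)

  s′-padded : ∀ k n d → sumFrom k (d + suc n) (term n) ≡ s′ k n
  s′-padded k n d = sumFrom-vanishing-tail k (suc n) d (term-vanish ∘ m+n≤o⇒n≤o k)

  s′-zero : ∀ n → s′ 0 n ≡ g₂ + s′ 1 n
  s′-zero n = cong (_+_ g₂) (sym (sumFrom-vanishing-tail 1 n 1 term-vanish))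

  s′-pascal : ∀ k n → s′ (suc k) (suc (suc n)) ≡ s′ (suc k) (suc n) + s′ k n
  s′-pascal k n = begin
    sumFrom (suc k) L (term (2 + n))
      ≡⟨ sumFrom-suc {term (2 + n)} k L ⟩
    sumFrom k L (term (2 + n) ∘ suc)
      ≡⟨ sumFrom-cong k L (term-pascal n) ⟩
    sumFrom k L (λ ℓ → term (1 + n) (suc ℓ) + term n ℓ)
      ≡⟨ sumFrom-+ {term (1 + n) ∘ suc} {term n} k L ⟩
    sumFrom k L (term (1 + n) ∘ suc) + sumFrom k L (term n)
      ≡⟨ cong₂ _+_ (sym (sumFrom-suc {term (1 + n)} k L)) (s′-padded k n 2) ⟩
    sumFrom (suc k) L (term (1 + n)) + s′ k n
      ≡⟨ cong (_+ s′ k n) (s′-padded (suc k) (suc n) 1) ⟩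
    s′ (suc k) (suc n) + s′ k n ∎
    where L = 3 + n

  s′-zero-pascal : ∀ n → s′ 0 (suc (suc n)) ≡ s′ 0 (suc n) + s′ 0 n
  s′-zero-pascal n = begin
    s′ 0 (2 + n)                 ≡⟨ s′-zero (2 + n) ⟩
    g₂ + s′ 1 (2 + n)            ≡⟨ cong (_+_ g₂) (s′-pascal 0 n) ⟩
    g₂ + (s′ 1 (1 + n) + s′ 0 n) ≡⟨ sym (+-assoc g₂ _ _) ⟩
    g₂ + s′ 1 (1 + n) + s′ 0 n   ≡⟨ cong (_+ s′ 0 n) (sym (s′-zero (1 + n))) ⟩
    s′ 0 (1 + n) + s′ 0 n        ∎

  aN-zero : ∀ k → aN g₁ g₂ k 0 ≡ 0
  aN-zero zero    = refl
  aN-zero (suc k) = refl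

  aN-suc-∸ : ∀ k x y → aN g₁ g₂ (suc k) (suc x ∸ y) ≡ aN g₁ g₂ (suc k) (x ∸ y) + aN g₁ g₂ k (suc x ∸ y)
  aN-suc-∸ k x       zero    = refl
  aN-suc-∸ k zero    (suc y) rewrite 0∸n≡0 y = sym (aN-zero k)
  aN-suc-∸ k (suc x) (suc y) = aN-suc-∸ k x y

  -- Truncated subtraction is harmless: aN k 0 = 0, just as a vanishes at nonpositive indices.
  a′ : ℕ → ℕ → ℕ
  a′ k n = aN g₁ g₂ k (suc (suc n) ∸ 2 ℕ.* k)

  a′-vanish : ∀ k n → suc (suc n) ≤ 2 ℕ.* k → a′ k n ≡ 0
  a′-vanish k n ≤2k = trans (cong (aN g₁ g₂ k) (m≤n⇒m∸n≡0 ≤2k)) (aN-zero k)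

  a′-pascal : ∀ k n → a′ (suc k) (suc (suc n)) ≡ a′ (suc k) (suc n) + a′ k n
  a′-pascal k n = begin
    aN g₁ g₂ (suc k) (4 + n ∸ 2 ℕ.* suc k)
      ≡⟨ cong (λ y → aN g₁ g₂ (suc k) (4 + n ∸ y)) (*-suc 2 k) ⟩
    aN g₁ g₂ (suc k) (2 + n ∸ 2 ℕ.* k)
      ≡⟨ aN-suc-∸ k (1 + n) (2 ℕ.* k) ⟩
    aN g₁ g₂ (suc k) (1 + n ∸ 2 ℕ.* k) + a′ k n
      ≡⟨ cong (λ y → aN g₁ g₂ (suc k) (3 + n ∸ y) + a′ k n) (*-suc 2 k) ⟨
    a′ (suc k) (suc n) + a′ k n ∎

  s′≡a′ : ∀ k n → s′ k n ≡ a′ k n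
  s′≡a′ zero          zero          = +-identityʳ g₂
  s′≡a′ (suc k)       zero          = sym (a′-vanish (suc k) 0 (*-monoʳ-≤ 2 (s≤s z≤n)))
  s′≡a′ zero          (suc zero)    = cong (_+_ g₂) (trans (+-identityʳ _) (+-identityʳ g₁))
  s′≡a′ (suc zero)    (suc zero)    = trans (+-identityʳ _) (+-identityʳ g₁)
  s′≡a′ (suc (suc k)) (suc zero)    =
    sym (a′-vanish (2 + k) 1 (≤-trans (n≤1+n 3) (*-monoʳ-≤ 2 (s≤s (s≤s z≤n)))))
  s′≡a′ zero          (suc (suc n)) = trans (s′-zero-pascal n) (cong₂ _+_ (s′≡a′ 0 (suc n)) (s′≡a′ 0 n))
  s′≡a′ (suc k)       (suc (suc n)) =
    trans (s′-pascal k n) (trans (cong₂ _+_ (s′≡a′ (suc k) (suc n)) (s′≡a′ k n)) (sym (a′-pascal k n)))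

  a-⊖ : ∀ k x y → a g₁ g₂ k (x ⊖ y) ≡ aN g₁ g₂ k (x ∸ y)
  a-⊖ k x       zero    = refl
  a-⊖ k zero    (suc y) = sym (aN-zero k)
  a-⊖ k (suc x) (suc y) = trans (cong (a g₁ g₂ k) ([1+m]⊖[1+n]≡m⊖n x y)) (a-⊖ k x y)

shifted-index : ∀ n k → + n - + 2 * (+ k - + 1) ≡ suc (suc n) ⊖ 2 ℕ.* k
shifted-index n k = begin
  + n - + 2 * (+ k - + 1)    ≡⟨ expand (+ n) (+ k) ⟩
  + (2 + n) - + 2 * + k      ≡⟨ cong (λ m → + (2 + n) - m) (pos-* 2 k) ⟨
  + (2 + n) - + (2 ℕ.* k)    ≡⟨ m-n≡m⊖n (2 + n) (2 ℕ.* k) ⟩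
  (2 + n) ⊖ (2 ℕ.* k)        ∎
  where
  expand : ∀ (n k : ℤ) → n - + 2 * (k - + 1) ≡ + 2 +ℤ n - + 2 * k
  expand = ℤ-Ring.solve-∀

theorem3p4 : (g₁ g₂ : ℕ) → g₁ ≥ 1 → g₂ ≥ 1 → (k n : ℕ) → n ≥ 1 →
    s g₁ g₂ k n ≡ a g₁ g₂ k (+ n - + 2 * (+ k - + 1))
theorem3p4 g₁ g₂ _ _ k n _ = begin
  s g₁ g₂ k n                            ≡⟨ s≡s′ g₁ g₂ k n ⟩
  s′ g₁ g₂ k n                           ≡⟨ s′≡a′ g₁ g₂ k n ⟩
  aN g₁ g₂ k (2 + n ∸ 2 ℕ.* k)           ≡⟨ a-⊖ g₁ g₂ k (2 + n) (2 ℕ.* k) ⟨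
  a g₁ g₂ k ((2 + n) ⊖ 2 ℕ.* k)          ≡⟨ cong (a g₁ g₂ k) (shifted-index n k) ⟨
  a g₁ g₂ k (+ n - + 2 * (+ k - + 1))    ∎
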